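{- \[ \lim_{n\to\infty} \frac{\gamma^*_e(\S_n)}{n^2} \le \frac{1}{19}. \]
   Context: For vertices $u,v$ of a graph $G$, $\dist(u,v)$ is the length of a shortest $uv$ path and $w^*(u,v) = 2^{1-\dist(u,v)}$. A set $D \subseteq V(G)$ is a porous exponential dominating set if $\sum_{d \in D} w^*(d,v) \ge 1$ for every $v \in V(G)$; the porous exponential domination number $\gamma^*_e(G)$ is the minimum cardinality of such a set. The Slant grid $\S_n$ is the Cartesian product $P_n \square P_n$ (vertex set $[n]\times[n]$, $(i,j)\sim(i',j')$ iff they agree in one coordinate and differ by $1$ in the other) together with the additional edges $(i,j) \sim (i+1,j+1)$ for $i,j \in [n-1]$. -}

module Defs where

open import Data.Bool using (Bool; true; false; _∧_; _∨_; if_then_else_)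
open import Data.Nat using (ℕ; zero; suc; _*_)
import Data.Nat as ℕ
open import Data.Fin using (Fin; toℕ)
import Data.Fin as Fin
open import Data.Product using (_×_; _,_; Σ)
open import Data.List using (List; []; _∷_; allFin; cartesianProduct; foldr; map; filter)
open import Data.Bool.ListAction using (any)
open import Data.Rational using (ℚ; 0ℚ; 1ℚ; ½; _+_; _≤_)
import Data.Rational as ℚ
open import Relation.Nullary.Decidable using (⌊_⌋)
open import Relation.Binary.PropositionalEquality using (_≡_)

-- Vertices of the Slant grid S_n: [n] × [n], coded 0-indexed as Fin n × Fin n.
Vertex : ℕ → Set
Vertex n = Fin n × Fin n

vertices : (n : ℕ) → List (Vertex n)
vertices n = cartesianProduct (allFin n) (allFin n)

diff1 : ℕ → ℕ → Bool
diff1 a b = ⌊ suc a ℕ.≟ b ⌋ ∨ ⌊ suc b ℕ.≟ a ⌋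

succOf : ℕ → ℕ → Bool
succOf a b = ⌊ suc a ℕ.≟ b ⌋

eqℕ : ℕ → ℕ → Bool
eqℕ a b = ⌊ a ℕ.≟ b ⌋

-- Adjacency in S_n: grid edges of P_n □ P_n plus the diagonals (i,j) ~ (i+1,j+1).
adj : {n : ℕ} → Vertex n → Vertex n → Bool
adj (i , j) (i' , j') =
     (eqℕ (toℕ i) (toℕ i') ∧ diff1 (toℕ j) (toℕ j'))
  ∨ (eqℕ (toℕ j) (toℕ j') ∧ diff1 (toℕ i) (toℕ i'))
  ∨ (succOf (toℕ i) (toℕ i') ∧ succOf (toℕ j) (toℕ j'))
  ∨ (succOf (toℕ i') (toℕ i) ∧ succOf (toℕ j') (toℕ j))

eqV : {n : ℕ} → Vertex n → Vertex n → Bool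
eqV (i , j) (i' , j') = eqℕ (toℕ i) (toℕ i') ∧ eqℕ (toℕ j) (toℕ j')

reach : (n : ℕ) → ℕ → Vertex n → Vertex n → Bool
reach n zero    u v = eqV u v
reach n (suc k) u v = reach n k u v ∨ any (λ w → adj u w ∧ reach n k w v) (vertices n)

search : (n : ℕ) → Vertex n → Vertex n → (start fuel : ℕ) → ℕ
search n u v start zero       = start
search n u v start (suc fuel) = if reach n start u v then start else search n u v (suc start) fuel

-- dist(u,v): length of a shortest uv path. S_n is connected and a shortest path
-- has at most n*n vertices, so searching k = 0 .. n*n finds it.
dist : (n : ℕ) → Vertex n → Vertex n → ℕ
dist n u v = search n u v 0 (n * n)

halfPow : ℕ → ℚ
halfPow zero    = 1ℚ
halfPow (suc k) = ½ ℚ.* halfPow k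

-- w*(u,v) = 2^(1 - dist(u,v))
wstar : (n : ℕ) → Vertex n → Vertex n → ℚ
wstar n u v = (1ℚ + 1ℚ) ℚ.* halfPow (dist n u v)

VSet : ℕ → Set
VSet n = Vertex n → Bool

members : {n : ℕ} → VSet n → List (Vertex n)
members {n} D = filter (λ v → Data.Bool._≟_ (D v) true) (vertices n)
  where import Data.Bool

card : {n : ℕ} → VSet n → ℕ
card D = Data.List.length (members D)

IsPED : (n : ℕ) → VSet n → Set
IsPED n D = (v : Vertex n) → 1ℚ ≤ foldr (λ d s → wstar n d v + s) 0ℚ (members D)

IsGammaStarE : (n : ℕ) → ℕ → Set
IsGammaStarE n g =
  Σ (VSet n) (λ D → IsPED n D × card D ≡ g) × ((D : VSet n) → IsPED n D → g ℕ.≤ card D)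

-- Take D = the four strips of width 4 along the border of [0,n)² together with the
-- vertices (a, b) with 19 ∣ 7a + b.  The code meets every run of 19 consecutive cells of a
-- row at most once, so 19 |D| ≤ n² + 323 n.  Vertices of D dominate themselves (weight 2).
-- Any other vertex is the centre of a 9×9 box inside the grid, and which cells of the box
-- are codewords depends only on the residue of 7a₀ + b₀ mod 19, (a₀, b₀) the box corner.
-- For each of the 19 patterns, explicit lattice paths from the codewords in the box to the
-- centre bound their distances and give total weight ≥ 1, as checked by evaluation.
module Submission where

open import Defs
open import Algebra.Bundles using (CommutativeMonoid)
open import Data.Bool using (Bool; true; false; T; _∧_; _∨_)
import Data.Bool as Bool
open import Data.Bool.ListAction using (all)
open import Data.Bool.Properties using (T-≡; ∨-zeroʳ)
open import Data.Fin using (Fin; toℕ)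
open import Data.Fin.Properties using (all?; toℕ-fromℕ<; nonZeroIndex)
open import Data.List using (List; []; _∷_; _++_; map; filter; length; replicate; foldr;
  tabulate; allFin; upTo; cartesianProduct)
open import Data.List.Membership.Propositional using (_∈_)
open import Data.List.Membership.Propositional.Properties
  using (∈-∃++; ∈-filter⁺; ∈-filter⁻; ∈-map⁻; ∈-cartesianProduct⁺; ∈-allFin)
open import Data.List.Properties using (map-++; map-∘; map-cong; map-cong-local; map-tabulate)
open import Data.List.Relation.Binary.Subset.Propositional using (_⊆_)
open import Data.List.Relation.Unary.All as All using (All; []; _∷_)
open import Data.List.Relation.Unary.All.Properties using (all⁺)
open import Data.List.Relation.Unary.Any as Any using (here; there)
open import Data.List.Relation.Unary.Any.Properties using (any⁺)
open import Data.List.Relation.Unary.Unique.Propositional using (Unique; []; _∷_)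
import Data.List.Relation.Unary.Unique.Propositional.Properties as Unique
open import Data.Nat using (ℕ; zero; suc; pred; _+_; _*_; _∸_; _⊓_; _/_; _%_; _≤_; _<_; _≤′_;
  ≤′-refl; ≤′-step; _<ᵇ_; z≤n; s≤s; z<s; s<s; NonZero)
import Data.Nat as ℕ
open import Data.Nat.DivMod using (_mod_; m≡m%n+[m/n]*n; m%n<n; m%n≤n; m/n*n≤m; m<n⇒m%n≡m)
open import Data.Nat.Divisibility using (_∣_; _∣?_; ∣m+n∣m⇒∣n; ∣m∣n⇒∣m+n; n∣m*n; ∣⇒≤)
open import Data.Nat.ListAction using (sum)
open import Data.Nat.ListAction.Properties using (sum-++)
open import Data.Nat.Properties
open import Data.Nat.Tactic.RingSolver using (solve-∀)
open import Data.Product using (Σ; _×_; _,_; proj₁; proj₂)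
open import Data.Product.Properties using (≡-dec)
open import Data.Rational using (ℚ; 0ℚ; 1ℚ; ½; nonNegative)
import Data.Rational as ℚ
import Data.Rational.Properties as ℚ
open import Function using (_∘_; Equivalence)
open import Relation.Binary.PropositionalEquality
open import Relation.Nullary using (¬_; Dec; does; yes; no; contradiction)
open import Relation.Nullary.Decidable using (⌊_⌋; dec-true; dec-false; fromWitness; toWitness)
open import Algebra.Properties.CommutativeSemigroup +-commutativeSemigroup using (interchange)
open import Algebra.Properties.CommutativeSemigroup
  (CommutativeMonoid.commutativeSemigroup ℚ.+-0-commutativeMonoid) using (x∙yz≈y∙xz)

∨-trueˡ : ∀ {a} b → a ≡ true → a ∨ b ≡ true
∨-trueˡ b refl = refl

∨-trueʳ : ∀ a {b} → b ≡ true → a ∨ b ≡ true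
∨-trueʳ a refl = ∨-zeroʳ a

∧-true : ∀ {a b} → a ≡ true → b ≡ true → a ∧ b ≡ true
∧-true refl refl = refl

∧-true⁻ : ∀ a {b} → a ∧ b ≡ true → a ≡ true × b ≡ true
∧-true⁻ true b≡true = refl , b≡true

-- Counting

sumBelow : ℕ → (ℕ → ℕ) → ℕ
sumBelow zero    f = 0
sumBelow (suc m) f = f 0 + sumBelow m (f ∘ suc)

sumBelow-cong : ∀ m {f g : ℕ → ℕ} → (∀ k → k < m → f k ≡ g k) → sumBelow m f ≡ sumBelow m g
sumBelow-cong zero    eq = refl
sumBelow-cong (suc m) eq = cong₂ _+_ (eq 0 z<s) (sumBelow-cong m (λ k k<m → eq (suc k) (s<s k<m)))

sumBelow-mono-≤ : ∀ m {f g : ℕ → ℕ} → (∀ k → f k ≤ g k) → sumBelow m f ≤ sumBelow m g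
sumBelow-mono-≤ zero    le = z≤n
sumBelow-mono-≤ (suc m) le = +-mono-≤ (le 0) (sumBelow-mono-≤ m (le ∘ suc))

sumBelow-+ : ∀ m (f g : ℕ → ℕ) → sumBelow m (λ k → f k + g k) ≡ sumBelow m f + sumBelow m g
sumBelow-+ zero    f g = refl
sumBelow-+ (suc m) f g =
  trans (cong (f 0 + g 0 +_) (sumBelow-+ m (f ∘ suc) (g ∘ suc))) (interchange (f 0) (g 0) _ _)

sumBelow-const : ∀ m c → sumBelow m (λ _ → c) ≡ m * c
sumBelow-const zero    c = refl
sumBelow-const (suc m) c = cong (c +_) (sumBelow-const m c)

sumBelow-*ˡ : ∀ m c (f : ℕ → ℕ) → sumBelow m (λ k → c * f k) ≡ c * sumBelow m f
sumBelow-*ˡ zero    c f = sym (*-zeroʳ c)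
sumBelow-*ˡ (suc m) c f =
  trans (cong (c * f 0 +_) (sumBelow-*ˡ m c (f ∘ suc))) (sym (*-distribˡ-+ c (f 0) _))

sumBelow-+-split : ∀ a b (f : ℕ → ℕ) → sumBelow (a + b) f ≡ sumBelow a f + sumBelow b (λ k → f (a + k))
sumBelow-+-split zero    b f = refl
sumBelow-+-split (suc a) b f =
  trans (cong (f 0 +_) (sumBelow-+-split a b (f ∘ suc))) (sym (+-assoc (f 0) _ _))

sum-tabulate-toℕ : ∀ n (f : ℕ → ℕ) → sum (tabulate {n = n} (f ∘ toℕ)) ≡ sumBelow n f
sum-tabulate-toℕ zero    f = refl
sum-tabulate-toℕ (suc n) f = cong (f 0 +_) (sum-tabulate-toℕ n (f ∘ suc))

sum-map-allFin : ∀ n (f : ℕ → ℕ) → sum (map (f ∘ toℕ) (allFin n)) ≡ sumBelow n f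
sum-map-allFin n f = trans (cong sum (map-tabulate {n = n} (λ i → i) (f ∘ toℕ))) (sum-tabulate-toℕ n f)

sum-map-cartesianProduct : ∀ {A B : Set} (f : A × B → ℕ) xs (ys : List B) →
  sum (map f (cartesianProduct xs ys)) ≡ sum (map (λ x → sum (map (λ y → f (x , y)) ys)) xs)
sum-map-cartesianProduct f []       ys = refl
sum-map-cartesianProduct f (x ∷ xs) ys = begin
  sum (map f (map (x ,_) ys ++ cartesianProduct xs ys))
    ≡⟨ cong sum (map-++ f (map (x ,_) ys) _) ⟩
  sum (map f (map (x ,_) ys) ++ map f (cartesianProduct xs ys))
    ≡⟨ sum-++ (map f (map (x ,_) ys)) _ ⟩
  sum (map f (map (x ,_) ys)) + sum (map f (cartesianProduct xs ys))
    ≡⟨ cong₂ _+_ (cong sum (sym (map-∘ ys))) (sum-map-cartesianProduct f xs ys) ⟩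
  sum (map (λ y → f (x , y)) ys) + sum (map (λ x → sum (map (λ y → f (x , y)) ys)) xs) ∎
  where open ≡-Reasoning

indicator : Bool → ℕ
indicator true  = 1
indicator false = 0

indicator-∨ : ∀ a b → indicator (a ∨ b) ≤ indicator a + indicator b
indicator-∨ true  b = s≤s z≤n
indicator-∨ false b = ≤-refl

length-filter-≡-sum : ∀ {A : Set} (P : A → Bool) xs →
  length (filter (λ x → P x Bool.≟ true) xs) ≡ sum (map (indicator ∘ P) xs)
length-filter-≡-sum P []       = refl
length-filter-≡-sum P (x ∷ xs) with P x
... | true  = cong suc (length-filter-≡-sum P xs)
... | false = length-filter-≡-sum P xs

coordinatewise : ∀ {n} → (ℕ → ℕ → Bool) → VSet n
coordinatewise P (i , j) = P (toℕ i) (toℕ j)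

card-coordinatewise : ∀ n (P : ℕ → ℕ → Bool) →
  card {n} (coordinatewise P) ≡ sumBelow n (λ a → sumBelow n (λ b → indicator (P a b)))
card-coordinatewise n P = begin
  length (filter _ (vertices n))
    ≡⟨ length-filter-≡-sum _ (vertices n) ⟩
  sum (map _ (cartesianProduct (allFin n) (allFin n)))
    ≡⟨ sum-map-cartesianProduct _ (allFin n) (allFin n) ⟩
  sum (map (λ i → sum (map (λ j → indicator (P (toℕ i) (toℕ j))) (allFin n))) (allFin n))
    ≡⟨ cong sum (map-cong (λ i → sum-map-allFin n (λ b → indicator (P (toℕ i) b))) (allFin n)) ⟩
  sum (map (λ i → sumBelow n (λ b → indicator (P (toℕ i) b))) (allFin n))
    ≡⟨ sum-map-allFin n (λ a → sumBelow n (λ b → indicator (P a b))) ⟩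
  sumBelow n (λ a → sumBelow n (λ b → indicator (P a b))) ∎
  where open ≡-Reasoning

count-<ᵇ : ∀ m a → sumBelow m (λ x → indicator (x <ᵇ a)) ≤ a
count-<ᵇ zero    a       = z≤n
count-<ᵇ (suc m) zero    = ≤-reflexive (trans (sumBelow-const m 0) (*-zeroʳ m))
count-<ᵇ (suc m) (suc a) = s≤s (count-<ᵇ m a)

count->ᵇ : ∀ m c → sumBelow m (λ x → indicator (c <ᵇ x)) ≤ m ∸ suc c
count->ᵇ zero    c       = z≤n
count->ᵇ (suc m) zero    = ≤-reflexive (trans (sumBelow-const m 1) (*-identityʳ m))
count->ᵇ (suc m) (suc c) = count->ᵇ m c

countMultiples : (d c m : ℕ) → ℕ
countMultiples d c m = sumBelow m (λ j → indicator (does (d ∣? c + j)))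

countMultiples-suc : ∀ d c m →
  countMultiples d c (suc m) ≡ indicator (does (d ∣? c)) + countMultiples d (suc c) m
countMultiples-suc d c m = cong₂ _+_
  (cong (λ x → indicator (does (d ∣? x))) (+-identityʳ c))
  (sumBelow-cong m (λ k _ → cong (λ x → indicator (does (d ∣? x))) (+-suc c k)))

countMultiples-+ : ∀ d c a b →
  countMultiples d c (a + b) ≡ countMultiples d c a + countMultiples d (c + a) b
countMultiples-+ d c a b = trans (sumBelow-+-split a b _) (cong (countMultiples d c a +_)
  (sumBelow-cong b (λ k _ → cong (λ x → indicator (does (d ∣? x))) (sym (+-assoc c a k)))))

countMultiples-none : ∀ d c m → (∀ j → j < m → ¬ d ∣ c + j) → countMultiples d c m ≡ 0
countMultiples-none d c m none = begin
  countMultiples d c m  ≡⟨ sumBelow-cong m (λ j j<m → cong indicator (dec-false (d ∣? c + j) (none j j<m))) ⟩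
  sumBelow m (λ _ → 0)  ≡⟨ sumBelow-const m 0 ⟩
  m * 0                 ≡⟨ *-zeroʳ m ⟩
  0                     ∎
  where open ≡-Reasoning

module _ {d : ℕ} .{{_ : NonZero d}} where

  countMultiples-window : ∀ c m → m ≤ d → countMultiples d c m ≤ 1
  countMultiples-window c zero    _   = z≤n
  countMultiples-window c (suc m) m<d with d ∣? c | countMultiples-suc d c m
  ... | no _    | eq = ≤-trans (≤-reflexive eq) (countMultiples-window (suc c) m (<⇒≤ m<d))
  ... | yes d∣c | eq = ≤-reflexive (trans eq (cong suc (countMultiples-none d (suc c) m none)))
    where
    none : ∀ j → j < m → ¬ d ∣ suc c + j
    none j j<m d∣ = <⇒≱ (≤-trans (s≤s j<m) m<d)
      (∣⇒≤ (∣m+n∣m⇒∣n (subst (d ∣_) (sym (+-suc c j)) d∣) d∣c))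

  countMultiples-blocks : ∀ q r c → r ≤ d → countMultiples d c (q * d + r) ≤ suc q
  countMultiples-blocks zero    r c r≤d = countMultiples-window c r r≤d
  countMultiples-blocks (suc q) r c r≤d = begin
    countMultiples d c (d + q * d + r)                           ≡⟨ cong (countMultiples d c) (+-assoc d (q * d) r) ⟩
    countMultiples d c (d + (q * d + r))                         ≡⟨ countMultiples-+ d c d (q * d + r) ⟩
    countMultiples d c d + countMultiples d (c + d) (q * d + r)  ≤⟨ +-mono-≤ (countMultiples-window c d ≤-refl)
                                                                             (countMultiples-blocks q r (c + d) r≤d) ⟩
    1 + suc q                                                    ∎
    where open ≤-Reasoning

  countMultiples-bound : ∀ c m → d * countMultiples d c m ≤ m + d
  countMultiples-bound c m = begin
    d * countMultiples d c m  ≤⟨ *-monoʳ-≤ d (subst (λ x → countMultiples d c x ≤ suc (m / d)) (sym m≡)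
                                   (countMultiples-blocks (m / d) (m % d) c (m%n≤n m d))) ⟩
    d * suc (m / d)           ≡⟨ *-suc d (m / d) ⟩
    d + d * (m / d)           ≡⟨ +-comm d _ ⟩
    d * (m / d) + d           ≡⟨ cong (_+ d) (*-comm d (m / d)) ⟩
    m / d * d + d             ≤⟨ +-monoˡ-≤ d (m/n*n≤m m d) ⟩
    m + d                     ∎
    where
    open ≤-Reasoning
    m≡ : m ≡ m / d * d + m % d
    m≡ = trans (m≡m%n+[m/n]*n m d) (+-comm (m % d) _)

-- The dominating set and its size

nearBorder : ℕ → ℕ → Bool
nearBorder n x = (x <ᵇ 4) ∨ (n ∸ 5 <ᵇ x)

isCodeword : ℕ → ℕ → Bool
isCodeword a b = does (19 ∣? 7 * a + b)

isDominator : ℕ → ℕ → ℕ → Bool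
isDominator n a b = nearBorder n a ∨ nearBorder n b ∨ isCodeword a b

dominatingSet : (n : ℕ) → VSet n
dominatingSet n = coordinatewise (isDominator n)

count-nearBorder : ∀ n → sumBelow n (λ x → indicator (nearBorder n x)) ≤ 8
count-nearBorder n = begin
  sumBelow n (λ x → indicator (nearBorder n x))
    ≤⟨ sumBelow-mono-≤ n (λ x → indicator-∨ (x <ᵇ 4) _) ⟩
  sumBelow n (λ x → indicator (x <ᵇ 4) + indicator (n ∸ 5 <ᵇ x))
    ≡⟨ sumBelow-+ n _ _ ⟩
  sumBelow n (λ x → indicator (x <ᵇ 4)) + sumBelow n (λ x → indicator (n ∸ 5 <ᵇ x))
    ≤⟨ +-mono-≤ (count-<ᵇ n 4) (count->ᵇ n (n ∸ 5)) ⟩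
  4 + (n ∸ suc (n ∸ 5))
    ≤⟨ +-monoʳ-≤ 4 (m≤n+o⇒m∸n≤o n (suc (n ∸ 5)) (subst (n ≤_) (cong suc (+-comm 4 (n ∸ 5))) (m≤n+m∸n n 5))) ⟩
  8 ∎
  where open ≤-Reasoning

row-bound : ∀ n a →
  19 * sumBelow n (λ b → indicator (isDominator n a b)) ≤ 19 * n * indicator (nearBorder n a) + (n + 171)
row-bound n a = begin
  19 * sumBelow n (λ b → indicator (isDominator n a b))
    ≤⟨ *-monoʳ-≤ 19 (sumBelow-mono-≤ n (λ b →
         ≤-trans (indicator-∨ (nearBorder n a) _) (+-monoʳ-≤ Ba (indicator-∨ (nearBorder n b) _)))) ⟩
  19 * sumBelow n (λ b → Ba + (indicator (nearBorder n b) + indicator (isCodeword a b)))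
    ≡⟨ cong (19 *_) (trans (sumBelow-+ n _ _) (cong₂ _+_ (sumBelow-const n Ba) (sumBelow-+ n _ _))) ⟩
  19 * (n * Ba + (borderCount + countMultiples 19 (7 * a) n))
    ≡⟨ distribute n Ba borderCount (countMultiples 19 (7 * a) n) ⟩
  19 * n * Ba + (19 * borderCount + 19 * countMultiples 19 (7 * a) n)
    ≤⟨ +-monoʳ-≤ (19 * n * Ba) (+-mono-≤ (*-monoʳ-≤ 19 (count-nearBorder n)) (countMultiples-bound (7 * a) n)) ⟩
  19 * n * Ba + (19 * 8 + (n + 19))
    ≡⟨ cong (19 * n * Ba +_) (trans (+-comm 152 (n + 19)) (+-assoc n 19 152)) ⟩
  19 * n * Ba + (n + 171) ∎
  where
  open ≤-Reasoning
  Ba = indicator (nearBorder n a)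
  borderCount = sumBelow n (λ b → indicator (nearBorder n b))
  distribute : ∀ n x y z → 19 * (n * x + (y + z)) ≡ 19 * n * x + (19 * y + 19 * z)
  distribute = solve-∀

card-dominatingSet : ∀ n → 19 * card (dominatingSet n) ≤ n * n + 323 * n
card-dominatingSet n = begin
  19 * card (dominatingSet n)
    ≡⟨ cong (19 *_) (card-coordinatewise n (isDominator n)) ⟩
  19 * sumBelow n (λ a → sumBelow n (λ b → indicator (isDominator n a b)))
    ≡⟨ sumBelow-*ˡ n 19 _ ⟨
  sumBelow n (λ a → 19 * sumBelow n (λ b → indicator (isDominator n a b)))
    ≤⟨ sumBelow-mono-≤ n (row-bound n) ⟩
  sumBelow n (λ a → 19 * n * indicator (nearBorder n a) + (n + 171))
    ≡⟨ trans (sumBelow-+ n _ _) (cong₂ _+_ (sumBelow-*ˡ n (19 * n) _) (sumBelow-const n _)) ⟩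
  19 * n * sumBelow n (λ a → indicator (nearBorder n a)) + n * (n + 171)
    ≤⟨ +-monoˡ-≤ (n * (n + 171)) (*-monoʳ-≤ (19 * n) (count-nearBorder n)) ⟩
  19 * n * 8 + n * (n + 171)
    ≡⟨ collect n ⟩
  n * n + 323 * n ∎
  where
  open ≤-Reasoning
  collect : ∀ n → 19 * n * 8 + n * (n + 171) ≡ n * n + 323 * n
  collect = solve-∀

-- Paths in the slant lattice

Point : Set
Point = ℕ × ℕ

_+ᵖ_ : Point → Point → Point
(x , y) +ᵖ (a , b) = x + a , y + b

+ᵖ-cancelʳ : ∀ o {p q} → p +ᵖ o ≡ q +ᵖ o → p ≡ q
+ᵖ-cancelʳ (a , b) {x , y} {x' , y'} eq =
  cong₂ _,_ (+-cancelʳ-≡ a x x' (cong proj₁ eq)) (+-cancelʳ-≡ b y y' (cong proj₂ eq))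

toPoint : ∀ {n} → Vertex n → Point
toPoint (i , j) = toℕ i , toℕ j

stepInSecond stepInFirst diagonalStep : Point → Point → Bool
stepInSecond (a , b) (a' , b') = eqℕ a a' ∧ diff1 b b'
stepInFirst  (a , b) (a' , b') = eqℕ b b' ∧ diff1 a a'
diagonalStep (a , b) (a' , b') = succOf a a' ∧ succOf b b'

adjacentᵖ : Point → Point → Bool
adjacentᵖ p q = stepInSecond p q ∨ stepInFirst p q ∨ diagonalStep p q ∨ diagonalStep q p

adj-toPoint : ∀ {n} (u w : Vertex n) → adj u w ≡ adjacentᵖ (toPoint u) (toPoint w)
adj-toPoint (i , j) (i' , j') = refl

eqℕ-≡ : ∀ {a b} → a ≡ b → eqℕ a b ≡ true
eqℕ-≡ {a} {b} a≡b = Equivalence.to T-≡ (fromWitness {a? = a ℕ.≟ b} a≡b)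

eqℕ-refl : ∀ a → eqℕ a a ≡ true
eqℕ-refl a = eqℕ-≡ refl

succOf-suc : ∀ a → succOf a (suc a) ≡ true
succOf-suc a = eqℕ-refl (suc a)

diff1-suc : ∀ a → diff1 a (suc a) ≡ true
diff1-suc a = ∨-trueˡ _ (succOf-suc a)

diff1-pred : ∀ a → diff1 (suc a) a ≡ true
diff1-pred a = ∨-trueʳ (succOf (suc a) a) (succOf-suc a)

adjacent-stepInSecond : ∀ p q → stepInSecond p q ≡ true → adjacentᵖ p q ≡ true
adjacent-stepInSecond p q = ∨-trueˡ _

adjacent-stepInFirst : ∀ p q → stepInFirst p q ≡ true → adjacentᵖ p q ≡ true
adjacent-stepInFirst p q = ∨-trueʳ (stepInSecond p q) ∘ ∨-trueˡ _

adjacent-diagonalStep : ∀ p q → diagonalStep p q ≡ true → adjacentᵖ p q ≡ true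
adjacent-diagonalStep p q = ∨-trueʳ (stepInSecond p q) ∘ ∨-trueʳ (stepInFirst p q) ∘ ∨-trueˡ _

adjacent-diagonalStep⁻ : ∀ p q → diagonalStep q p ≡ true → adjacentᵖ p q ≡ true
adjacent-diagonalStep⁻ p q =
  ∨-trueʳ (stepInSecond p q) ∘ ∨-trueʳ (stepInFirst p q) ∘ ∨-trueʳ (diagonalStep p q)

data Direction : Set where
  east west north south northeast southwest : Direction

move : Direction → Point → Point
move east      (x , y) = suc x , y
move west      (x , y) = pred x , y
move north     (x , y) = x , suc y
move south     (x , y) = x , pred y
move northeast (x , y) = suc x , suc y
move southwest (x , y) = pred x , pred y

staysInℕ² : Direction → Point → Bool
staysInℕ² west      (x , y) = 0 <ᵇ x
staysInℕ² south     (x , y) = 0 <ᵇ y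
staysInℕ² southwest (x , y) = (0 <ᵇ x) ∧ (0 <ᵇ y)
staysInℕ² _         _       = true

adjacent-move : ∀ d p o → staysInℕ² d p ≡ true → adjacentᵖ (p +ᵖ o) (move d p +ᵖ o) ≡ true
adjacent-move east (x , y) (a , b) _ = adjacent-stepInFirst (x + a , y + b) (suc (x + a) , y + b)
  (∧-true (eqℕ-refl (y + b)) (diff1-suc (x + a)))
adjacent-move west (suc x , y) (a , b) _ = adjacent-stepInFirst (suc (x + a) , y + b) (x + a , y + b)
  (∧-true (eqℕ-refl (y + b)) (diff1-pred (x + a)))
adjacent-move north (x , y) (a , b) _ = adjacent-stepInSecond (x + a , y + b) (x + a , suc (y + b))
  (∧-true (eqℕ-refl (x + a)) (diff1-suc (y + b)))
adjacent-move south (x , suc y) (a , b) _ = adjacent-stepInSecond (x + a , suc (y + b)) (x + a , y + b)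
  (∧-true (eqℕ-refl (x + a)) (diff1-pred (y + b)))
adjacent-move northeast (x , y) (a , b) _ =
  adjacent-diagonalStep (x + a , y + b) (suc (x + a) , suc (y + b))
    (∧-true (succOf-suc (x + a)) (succOf-suc (y + b)))
adjacent-move southwest (suc x , suc y) (a , b) _ =
  adjacent-diagonalStep⁻ (suc (x + a) , suc (y + b)) (x + a , y + b)
    (∧-true (succOf-suc (x + a)) (succOf-suc (y + b)))

inBox : ℕ → Point → Bool
inBox s (x , y) = (x <ᵇ s) ∧ (y <ᵇ s)

_≟ᵖ_ : (p q : Point) → Dec (p ≡ q)
_≟ᵖ_ = ≡-dec ℕ._≟_ ℕ._≟_

leadsTo : ℕ → Point → List Direction → Point → Bool
leadsTo s p []       q = inBox s p ∧ ⌊ p ≟ᵖ q ⌋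
leadsTo s p (d ∷ ds) q = inBox s p ∧ (staysInℕ² d p ∧ leadsTo s (move d p) ds q)

leadsTo-inBox : ∀ s p ds q → leadsTo s p ds q ≡ true → inBox s p ≡ true
leadsTo-inBox s p []      q = proj₁ ∘ ∧-true⁻ (inBox s p)
leadsTo-inBox s p (_ ∷ _) q = proj₁ ∘ ∧-true⁻ (inBox s p)

∈-vertices : ∀ {n} (v : Vertex n) → v ∈ vertices n
∈-vertices (i , j) = ∈-cartesianProduct⁺ (∈-allFin i) (∈-allFin j)

reach-refl : ∀ {n} (u v : Vertex n) → toPoint u ≡ toPoint v → reach n 0 u v ≡ true
reach-refl (i , j) (i' , j') eq = ∧-true (eqℕ-≡ (cong proj₁ eq)) (eqℕ-≡ (cong proj₂ eq))

reach-step : ∀ {n k} (u w v : Vertex n) → adj u w ≡ true → reach n k w v ≡ true → reach n (suc k) u v ≡ true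
reach-step {n} {k} u w v uw wv = ∨-trueʳ (reach n k u v) (Equivalence.to T-≡
  (any⁺ (λ w → adj u w ∧ reach n k w v) (Any.map (λ { refl → Equivalence.from T-≡ (∧-true uw wv) }) (∈-vertices w))))

module _ {n : ℕ} .{{_ : NonZero n}} where

  -- Reduction mod n only serves to make toVertex total; it is exact on [0,n)².
  toVertex : Point → Vertex n
  toVertex (x , y) = x mod n , y mod n

  toℕ-mod : ∀ {x} → x < n → toℕ (x mod n) ≡ x
  toℕ-mod {x} x<n = trans (toℕ-fromℕ< (m%n<n x n)) (m<n⇒m%n≡m x<n)

  toPoint-toVertex-inBox : ∀ s o → s + proj₁ o ≤ n → s + proj₂ o ≤ n →
    ∀ p → inBox s p ≡ true → toPoint (toVertex (p +ᵖ o)) ≡ p +ᵖ o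
  toPoint-toVertex-inBox s (a , b) a-fits b-fits (x , y) p∈box = cong₂ _,_
    (toℕ-mod (<-≤-trans (+-monoˡ-< a (<ᵇ⇒< x s (Equivalence.from T-≡ x<s))) a-fits))
    (toℕ-mod (<-≤-trans (+-monoˡ-< b (<ᵇ⇒< y s (Equivalence.from T-≡ y<s))) b-fits))
    where
    x<s = proj₁ (∧-true⁻ (x <ᵇ s) p∈box)
    y<s = proj₂ (∧-true⁻ (x <ᵇ s) p∈box)

  reach-leadsTo : ∀ s o → s + proj₁ o ≤ n → s + proj₂ o ≤ n → ∀ p ds q (u v : Vertex n) →
    leadsTo s p ds q ≡ true → toPoint u ≡ p +ᵖ o → toPoint v ≡ q +ᵖ o → reach n (length ds) u v ≡ true
  reach-leadsTo s o a-fits b-fits p [] q u v p⇝q u≡ v≡ =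
    reach-refl u v (trans u≡ (trans (cong (_+ᵖ o) p≡q) (sym v≡)))
    where
    p≡q = toWitness {a? = p ≟ᵖ q} (Equivalence.from T-≡ (proj₂ (∧-true⁻ (inBox s p) p⇝q)))
  reach-leadsTo s o a-fits b-fits p (d ∷ ds) q u v p⇝q u≡ v≡ =
    reach-step {k = length ds} u w v u~w (reach-leadsTo s o a-fits b-fits p' ds q w v p'⇝q w≡ v≡)
    where
    p' = move d p
    w = toVertex (p' +ᵖ o)
    step = proj₂ (∧-true⁻ (inBox s p) p⇝q)
    p'⇝q = proj₂ (∧-true⁻ (staysInℕ² d p) step)
    w≡ = toPoint-toVertex-inBox s o a-fits b-fits p' (leadsTo-inBox s p' ds q p'⇝q)
    u~w : adj u w ≡ true
    u~w = trans (adj-toPoint u w) (subst₂ (λ a b → adjacentᵖ a b ≡ true) (sym u≡) (sym w≡)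
            (adjacent-move d p o (proj₁ (∧-true⁻ (staysInℕ² d p) step))))

-- When the fuel runs out, search returns its starting value, so no fuel bound is needed.
search-≤ : ∀ {n k} (u v : Vertex n) s fuel → s ≤ k → reach n k u v ≡ true → search n u v s fuel ≤ k
search-≤ u v s zero       s≤k _ = s≤k
search-≤ {n} {k} u v s (suc fuel) s≤k reach-k with reach n s u v in reach-s
... | true  = s≤k
... | false = search-≤ u v (suc s) fuel
  (≤∧≢⇒< s≤k (λ { refl → contradiction (trans (sym reach-k) reach-s) λ () })) reach-k

dist-≤ : ∀ {n k} (u v : Vertex n) → reach n k u v ≡ true → dist n u v ≤ k
dist-≤ {n} u v = search-≤ u v 0 (n * n) z≤n

-- Weights and domination

weight : ℕ → ℚ
weight k = (1ℚ ℚ.+ 1ℚ) ℚ.* halfPow k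

halfPow-nonNeg : ∀ k → 0ℚ ℚ.≤ halfPow k
halfPow-nonNeg zero    = ℚ.≤ᵇ⇒≤ _
halfPow-nonNeg (suc k) = ℚ.*-monoˡ-≤-nonNeg ½ (halfPow-nonNeg k)

halfPow-suc-≤ : ∀ k → halfPow (suc k) ℚ.≤ halfPow k
halfPow-suc-≤ k = subst (halfPow (suc k) ℚ.≤_) (ℚ.*-identityˡ (halfPow k))
  (ℚ.*-monoʳ-≤-nonNeg (halfPow k) {{nonNegative (halfPow-nonNeg k)}} {½} {1ℚ} (ℚ.≤ᵇ⇒≤ _))

halfPow-antitone : ∀ {m k} → m ≤ k → halfPow k ℚ.≤ halfPow m
halfPow-antitone = go ∘ ≤⇒≤′
  where
  go : ∀ {m k} → m ≤′ k → halfPow k ℚ.≤ halfPow m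
  go ≤′-refl           = ℚ.≤-refl
  go (≤′-step {k} m≤k) = ℚ.≤-trans (halfPow-suc-≤ k) (go m≤k)

weight-nonNeg : ∀ k → 0ℚ ℚ.≤ weight k
weight-nonNeg k = ℚ.*-monoˡ-≤-nonNeg (1ℚ ℚ.+ 1ℚ) (halfPow-nonNeg k)

weight-antitone : ∀ {m k} → m ≤ k → weight k ℚ.≤ weight m
weight-antitone m≤k = ℚ.*-monoˡ-≤-nonNeg (1ℚ ℚ.+ 1ℚ) (halfPow-antitone m≤k)

∑ : {A : Set} → (A → ℚ) → List A → ℚ
∑ f = foldr (λ x s → f x ℚ.+ s) 0ℚ

∑-middle : ∀ {A : Set} (f : A → ℚ) ys {x zs} → ∑ f (ys ++ x ∷ zs) ≡ f x ℚ.+ ∑ f (ys ++ zs)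
∑-middle f []           = refl
∑-middle f (y ∷ ys) {x} = trans (cong (f y ℚ.+_) (∑-middle f ys)) (x∙yz≈y∙xz (f y) (f x) _)

∑-map-mono : ∀ {A B : Set} (g : A → ℚ) (f : B → ℚ) (e : A → B) xs →
  (∀ {x} → x ∈ xs → g x ℚ.≤ f (e x)) → ∑ g xs ℚ.≤ ∑ f (map e xs)
∑-map-mono g f e []       _  = ℚ.≤-refl
∑-map-mono g f e (x ∷ xs) le = ℚ.+-mono-≤ (le (here refl)) (∑-map-mono g f e xs (le ∘ there))

∈-++-∷⁻ : ∀ {A : Set} ys {zs} {x y : A} → y ∈ ys ++ x ∷ zs → y ≢ x → y ∈ ys ++ zs
∈-++-∷⁻ []       (here refl) y≢x = contradiction refl y≢x
∈-++-∷⁻ []       (there y∈)  _   = y∈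
∈-++-∷⁻ (_ ∷ ys) (here refl) _   = here refl
∈-++-∷⁻ (_ ∷ ys) (there y∈)  y≢x = there (∈-++-∷⁻ ys y∈ y≢x)

module _ {A : Set} (f : A → ℚ) (f≥0 : ∀ x → 0ℚ ℚ.≤ f x) where

  ∑-nonNeg : ∀ xs → 0ℚ ℚ.≤ ∑ f xs
  ∑-nonNeg []       = ℚ.≤-refl
  ∑-nonNeg (x ∷ xs) = ℚ.+-mono-≤ (f≥0 x) (∑-nonNeg xs)

  ∑-mono-⊆ : ∀ {xs ys} → Unique xs → xs ⊆ ys → ∑ f xs ℚ.≤ ∑ f ys
  ∑-mono-⊆ {[]}     {ys} _                  _     = ∑-nonNeg ys
  ∑-mono-⊆ {x ∷ xs} {ys} (x≢xs ∷ unique-xs) xs⊆ys with ∈-∃++ (xs⊆ys (here refl))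
  ... | ys₁ , ys₂ , refl = ℚ.≤-trans
    (ℚ.+-monoʳ-≤ (f x) (∑-mono-⊆ unique-xs λ y∈xs →
       ∈-++-∷⁻ ys₁ (xs⊆ys (there y∈xs)) λ { refl → All.lookup x≢xs y∈xs refl }))
    (ℚ.≤-reflexive (sym (∑-middle f ys₁)))

  ∑-≥-∈ : ∀ {x xs} → x ∈ xs → f x ℚ.≤ ∑ f xs
  ∑-≥-∈ {x} x∈xs = ℚ.≤-trans (ℚ.≤-reflexive (sym (ℚ.+-identityʳ (f x))))
    (∑-mono-⊆ ([] ∷ []) λ { (here refl) → x∈xs })

∈-members : ∀ {n} (D : VSet n) {v} → D v ≡ true → v ∈ members D
∈-members D {v} Dv = ∈-filter⁺ (λ w → D w Bool.≟ true) (∈-vertices v) Dv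

member-dominated : ∀ {n} (D : VSet n) v → D v ≡ true → 1ℚ ℚ.≤ ∑ (λ d → wstar n d v) (members D)
member-dominated {n} D v Dv =
  ℚ.≤-trans (ℚ.≤-trans (ℚ.≤ᵇ⇒≤ _) (weight-antitone (dist-≤ {k = 0} v v (reach-refl v v refl))))
    (∑-≥-∈ (λ d → wstar n d v) (λ d → weight-nonNeg (dist n d v)) (∈-members D Dv))

route : Point → Point → List Direction
route (x , y) (x' , y') =
     replicate (e ⊓ n) northeast ++ replicate (w ⊓ s) southwest
  ++ replicate (e ∸ n) east ++ replicate (w ∸ s) west
  ++ replicate (n ∸ e) north ++ replicate (s ∸ w) south
  where
  e = x' ∸ x
  w = x ∸ x'
  n = y' ∸ y
  s = y ∸ y'

centre : Point
centre = 4 , 4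

codewordOffset? : ∀ ρ (p : Point) → Dec (19 ∣ ρ + (7 * proj₁ p + proj₂ p))
codewordOffset? ρ p = 19 ∣? ρ + (7 * proj₁ p + proj₂ p)

codewordOffsets : ℕ → List Point
codewordOffsets ρ = filter (codewordOffset? ρ) (cartesianProduct (upTo 9) (upTo 9))

unique-codewordOffsets : ∀ ρ → Unique (codewordOffsets ρ)
unique-codewordOffsets ρ =
  Unique.filter⁺ (codewordOffset? ρ) (Unique.cartesianProduct⁺ (Unique.upTo⁺ 9) (Unique.upTo⁺ 9))

certified : ℕ → Bool
certified ρ = all (λ p → leadsTo 9 p (route p centre) centre) (codewordOffsets ρ)
            ∧ (1ℚ ℚ.≤ᵇ ∑ (λ p → weight (length (route p centre))) (codewordOffsets ρ))

certified-all : ∀ (ρ : Fin 19) → certified (toℕ ρ) ≡ true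
certified-all = toWitness {a? = all? (λ ρ → certified (toℕ ρ) Bool.≟ true)} _

-- Moving the 9×9 box by (a₀, b₀) adds 7a₀ + b₀ to every code value, so the 19 certificates
-- cover every box.
isCodeword-shift : ∀ a₀ b₀ x y → 19 ∣ toℕ ((7 * a₀ + b₀) mod 19) + (7 * x + y) →
  isCodeword (x + a₀) (y + b₀) ≡ true
isCodeword-shift a₀ b₀ x y 19∣ρ+s = dec-true (19 ∣? _) (subst (19 ∣_) shape
  (∣m∣n⇒∣m+n (subst (λ r → 19 ∣ r + s) (toℕ-fromℕ< (m%n<n c 19)) 19∣ρ+s) (n∣m*n (c / 19))))
  where
  c = 7 * a₀ + b₀
  s = 7 * x + y
  shape : c % 19 + s + c / 19 * 19 ≡ 7 * (x + a₀) + (y + b₀)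
  shape = begin
    c % 19 + s + c / 19 * 19    ≡⟨ regroup (c % 19) s (c / 19 * 19) ⟩
    s + (c % 19 + c / 19 * 19)  ≡⟨ cong (s +_) (m≡m%n+[m/n]*n c 19) ⟨
    s + c                       ≡⟨ spread x y a₀ b₀ ⟩
    7 * (x + a₀) + (y + b₀)     ∎
    where
    open ≡-Reasoning
    regroup : ∀ r s q → r + s + q ≡ s + (r + q)
    regroup = solve-∀
    spread : ∀ x y a b → 7 * x + y + (7 * a + b) ≡ 7 * (x + a) + (y + b)
    spread = solve-∀

codeword-∈ : ∀ {n} (u : Vertex n) {a b} → toPoint u ≡ (a , b) → isCodeword a b ≡ true →
  u ∈ members (dominatingSet n)
codeword-∈ {n} u@(i , j) {a} {b} refl code =
  ∈-members (dominatingSet n) {u} (∨-trueʳ (nearBorder n a) (∨-trueʳ (nearBorder n b) code))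

interior-dominated : ∀ {n} (v : Vertex n) a₀ b₀ → 9 + a₀ ≤ n → 9 + b₀ ≤ n →
  toPoint v ≡ centre +ᵖ (a₀ , b₀) → 1ℚ ℚ.≤ ∑ (λ d → wstar n d v) (members (dominatingSet n))
interior-dominated {n} v@(i , _) a₀ b₀ a-fits b-fits v≡ = begin
  1ℚ                                                 ≤⟨ ℚ.≤ᵇ⇒≤ (Equivalence.from T-≡ (proj₂ certificate)) ⟩
  ∑ (λ p → weight (length (route p centre))) cs      ≤⟨ ∑-map-mono _ (λ d → wstar n d v) codewordAt cs route-bound ⟩
  ∑ (λ d → wstar n d v) (map codewordAt cs)          ≤⟨ ∑-mono-⊆ (λ d → wstar n d v) (λ d → weight-nonNeg (dist n d v))
                                                          unique-codewords codewords-∈ ⟩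
  ∑ (λ d → wstar n d v) (members (dominatingSet n))  ∎
  where
  open ℚ.≤-Reasoning
  instance _ = nonZeroIndex i
  o = a₀ , b₀
  ρ = (7 * a₀ + b₀) mod 19
  cs = codewordOffsets (toℕ ρ)
  certificate = ∧-true⁻ _ (certified-all ρ)

  codewordAt : Point → Vertex n
  codewordAt p = toVertex (p +ᵖ o)

  path : ∀ {p} → p ∈ cs → leadsTo 9 p (route p centre) centre ≡ true
  path p∈cs = Equivalence.to T-≡ (All.lookup (all⁺ _ cs (Equivalence.from T-≡ (proj₁ certificate))) p∈cs)

  toPoint-codewordAt : ∀ {p} → p ∈ cs → toPoint (codewordAt p) ≡ p +ᵖ o
  toPoint-codewordAt {p} p∈cs =
    toPoint-toVertex-inBox 9 o a-fits b-fits p (leadsTo-inBox 9 p (route p centre) centre (path p∈cs))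

  route-bound : ∀ {p} → p ∈ cs → weight (length (route p centre)) ℚ.≤ wstar n (codewordAt p) v
  route-bound {p} p∈cs = weight-antitone (dist-≤ {k = length (route p centre)} (codewordAt p) v
    (reach-leadsTo 9 o a-fits b-fits p (route p centre) centre (codewordAt p) v
       (path p∈cs) (toPoint-codewordAt p∈cs) v≡))

  codewords-∈ : map codewordAt cs ⊆ members (dominatingSet n)
  codewords-∈ d∈ with ∈-map⁻ codewordAt d∈
  ... | (x , y) , p∈cs , refl = codeword-∈ (codewordAt (x , y)) (toPoint-codewordAt p∈cs)
    (isCodeword-shift a₀ b₀ x y (proj₂ (∈-filter⁻ (codewordOffset? (toℕ ρ)) p∈cs)))

  unique-codewords : Unique (map codewordAt cs)
  unique-codewords = Unique.map⁻ {f = toPoint {n}} (subst Unique (sym toPoint-map)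
    (Unique.map⁺ (+ᵖ-cancelʳ o) (unique-codewordOffsets (toℕ ρ))))
    where
    toPoint-map : map toPoint (map codewordAt cs) ≡ map (_+ᵖ o) cs
    toPoint-map = trans (sym (map-∘ cs)) (map-cong-local (All.tabulate toPoint-codewordAt))

<ᵇ-false⇒≥ : ∀ {m n} → (m <ᵇ n) ≡ false → n ≤ m
<ᵇ-false⇒≥ m≮n = ≮⇒≥ (λ m<n → subst T m≮n (<⇒<ᵇ m<n))

interior-coordinate : ∀ n a → nearBorder n a ≡ false → Σ ℕ λ a₀ → a ≡ 4 + a₀ × 9 + a₀ ≤ n
interior-coordinate n a not-near with a <ᵇ 4 in a≮4 | n ∸ 5 <ᵇ a in n∸5≮a
... | false | false = a ∸ 4 , sym (m+[n∸m]≡n 4≤a) , (begin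
  9 + (a ∸ 4)  ≡⟨ cong (5 +_) (m+[n∸m]≡n 4≤a) ⟩
  5 + a        ≡⟨ +-comm 5 a ⟩
  a + 5        ≤⟨ m≤o∸n⇒m+n≤o a 5≤n a≤n∸5 ⟩
  n            ∎)
  where
  open ≤-Reasoning
  4≤a = <ᵇ-false⇒≥ a≮4
  a≤n∸5 = <ᵇ-false⇒≥ n∸5≮a
  5≤n : 5 ≤ n
  5≤n = <⇒≤ (m∸n≢0⇒n<m λ n∸5≡0 → <⇒≱ (s≤s z≤n) (subst (4 ≤_) n∸5≡0 (≤-trans 4≤a a≤n∸5)))

dominatingSet-isPED : ∀ n → IsPED n (dominatingSet n)
dominatingSet-isPED n v@(i , j) with nearBorder n (toℕ i) in i-near | nearBorder n (toℕ j) in j-near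
... | true  | _     = member-dominated (dominatingSet n) v (∨-trueˡ _ i-near)
... | false | true  = member-dominated (dominatingSet n) v (∨-trueʳ (nearBorder n (toℕ i)) (∨-trueˡ _ j-near))
... | false | false with interior-coordinate n (toℕ i) i-near | interior-coordinate n (toℕ j) j-near
...   | a₀ , i≡ , a-fits | b₀ , j≡ , b-fits = interior-dominated v a₀ b₀ a-fits b-fits (cong₂ _,_ i≡ j≡)

γ*-bound : ∀ n g → IsGammaStarE n g → 19 * g ≤ n * n + 323 * n
γ*-bound n g (_ , minimal) =
  ≤-trans (*-monoʳ-≤ 19 (minimal (dominatingSet n) (dominatingSet-isPED n))) (card-dominatingSet n)

theorem3p6 : (γ : ℕ → ℕ) → ((n : ℕ) → IsGammaStarE n (γ n)) →
  (k : ℕ) → Σ ℕ (λ N → (n : ℕ) → N ≤ n →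
    19 * suc k * γ n ≤ suc k * (n * n) + 19 * (n * n))
theorem3p6 γ isγ k = 17 * suc k , λ n N≤n → begin
  19 * suc k * γ n                         ≡⟨ rearrange (suc k) (γ n) ⟩
  suc k * (19 * γ n)                       ≤⟨ *-monoʳ-≤ (suc k) (γ*-bound n (γ n) (isγ n)) ⟩
  suc k * (n * n + 323 * n)                ≡⟨ split (suc k) n ⟩
  suc k * (n * n) + 19 * (17 * suc k * n)  ≤⟨ +-monoʳ-≤ (suc k * (n * n)) (*-monoʳ-≤ 19 (*-monoˡ-≤ n N≤n)) ⟩
  suc k * (n * n) + 19 * (n * n)           ∎
  where
  open ≤-Reasoning
  rearrange : ∀ k g → 19 * k * g ≡ k * (19 * g)
  rearrange = solve-∀
  split : ∀ k n → k * (n * n + 323 * n) ≡ k * (n * n) + 19 * (17 * k * n)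
  split = solve-∀
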